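{- Each of the classes of MC-algebras, MBC-algebras, HBC-algebras and HBCK-algebras is a variety, i.e. is the class of all $(\to,e)$-algebras satisfying some set of equations.
   Context: An implicative algebra is a set $M$ with a binary operation $\to$ and a constant $e$ satisfying for all $x,y,z$: $x\to x=e$, $e\to x=x$, implicative anti-symmetry (if $x\to y=e$ and $y\to x=e$ then $x=y$) and implicative monotonicity (if $y\to z=e$ then $(x\to y)\to(x\to z)=e$). With $t(x,y)=(x\to y)\to y$, consider the axioms: H: $(x\to y)\to(x\to z)=(y\to x)\to(y\to z)$; M: $(t(x,y)\to x)\to(t(x,y)\to z)=x\to z$; B: $(x\to y)\to((z\to x)\to(z\to y))=e$; C: $x\to(y\to z)=y\to(x\to z)$; K: $x\to(y\to x)=e$. An MC-algebra is an implicative algebra satisfying M and C; MBC: M, B, C; HBC: H, B, C; HBCK: H, B, C, K. -}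

module Defs where

open import Data.Nat using (ℕ)
open import Data.Product using (_×_; _,_)
open import Relation.Binary.PropositionalEquality using (_≡_)

module _ {A : Set} (_⇒_ : A → A → A) (e : A) where

  IsImplicativeAlgebra : Set
  IsImplicativeAlgebra =
      (∀ x → x ⇒ x ≡ e)
    × (∀ x → e ⇒ x ≡ x)
    × (∀ x y → x ⇒ y ≡ e → y ⇒ x ≡ e → x ≡ y)
    × (∀ x y z → y ⇒ z ≡ e → (x ⇒ y) ⇒ (x ⇒ z) ≡ e)

  t : A → A → A
  t x y = (x ⇒ y) ⇒ y

  AxH : Set
  AxH = ∀ x y z → (x ⇒ y) ⇒ (x ⇒ z) ≡ (y ⇒ x) ⇒ (y ⇒ z)

  AxM : Set
  AxM = ∀ x y z → (t x y ⇒ x) ⇒ (t x y ⇒ z) ≡ x ⇒ z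

  AxB : Set
  AxB = ∀ x y z → (x ⇒ y) ⇒ ((z ⇒ x) ⇒ (z ⇒ y)) ≡ e

  AxC : Set
  AxC = ∀ x y z → x ⇒ (y ⇒ z) ≡ y ⇒ (x ⇒ z)

  AxK : Set
  AxK = ∀ x y → x ⇒ (y ⇒ x) ≡ e

data Class : Set where
  MC MBC HBC HBCK : Class

InClass : Class → {A : Set} → (A → A → A) → A → Set
InClass MC   _⇒_ e = IsImplicativeAlgebra _⇒_ e × AxM _⇒_ e × AxC _⇒_ e
InClass MBC  _⇒_ e = IsImplicativeAlgebra _⇒_ e × AxM _⇒_ e × AxB _⇒_ e × AxC _⇒_ e
InClass HBC  _⇒_ e = IsImplicativeAlgebra _⇒_ e × AxH _⇒_ e × AxB _⇒_ e × AxC _⇒_ e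
InClass HBCK _⇒_ e = IsImplicativeAlgebra _⇒_ e × AxH _⇒_ e × AxB _⇒_ e × AxC _⇒_ e × AxK _⇒_ e

data Term : Set where
  var : ℕ → Term
  ε   : Term
  _⟶_ : Term → Term → Term

Equation : Set
Equation = Term × Term

eval : {A : Set} → (A → A → A) → A → (ℕ → A) → Term → A
eval _⇒_ e ρ (var n) = ρ n
eval _⇒_ e ρ ε = e
eval _⇒_ e ρ (s ⟶ u) = eval _⇒_ e ρ s ⇒ eval _⇒_ e ρ u

Satisfies : {A : Set} → (A → A → A) → A → Equation → Set
Satisfies _⇒_ e (s , u) = ∀ (ρ : ℕ → _) → eval _⇒_ e ρ s ≡ eval _⇒_ e ρ u

Models : {A : Set} → (A → A → A) → A → (Equation → Set) → Set
Models _⇒_ e E = ∀ eq → E eq → Satisfies _⇒_ e eq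

{-# OPTIONS --safe #-}
module Submission where

-- Anti-symmetry and monotonicity are quasi-identities; each is traded for an identity.
-- Given e → x = x, monotonicity is a consequence of B, and B holds in every implicative
-- algebra with C. Anti-symmetry follows from the identity t(t(t(x,y),x),y) = t(t(x,y),x):
-- if x ≤ y ≤ x then t(x,y) = y and t(y,x) = x, so the two sides collapse to y and x.
-- This identity holds in every MC-algebra, and H implies M in the presence of C, so all
-- four classes consist of MC-algebras and are axiomatised by x → x = e, e → x = x, B, C,
-- the t-identity, and their own defining identities.

open import Data.Nat using (ℕ; suc)
open import Data.Product using (Σ; _,_; proj₁; proj₂)
open import Function.Bundles using (_⇔_; mk⇔)
open import Relation.Binary.PropositionalEquality
  using (_≡_; sym; trans; cong; subst; module ≡-Reasoning)
open ≡-Reasoning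

open import Defs

X Y Z : Term
X = var 0
Y = var 1
Z = var 2

tTerm : Term → Term → Term
tTerm s u = (s ⟶ u) ⟶ u

data Basis : Equation → Set where
  x⇒x≈e      : Basis (X ⟶ X , ε)
  e⇒x≈x      : Basis (ε ⟶ X , X)
  C-identity : Basis (X ⟶ (Y ⟶ Z) , Y ⟶ (X ⟶ Z))
  B-identity : Basis ((X ⟶ Y) ⟶ ((Z ⟶ X) ⟶ (Z ⟶ Y)) , ε)
  t-identity : Basis (tTerm (tTerm X Y) X , tTerm (tTerm (tTerm X Y) X) Y)

M-identity H-identity K-identity : Equation
M-identity = (tTerm X Y ⟶ X) ⟶ (tTerm X Y ⟶ Z) , X ⟶ Z
H-identity = (X ⟶ Y) ⟶ (X ⟶ Z) , (Y ⟶ X) ⟶ (Y ⟶ Z)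
K-identity = X ⟶ (Y ⟶ X) , ε

data Axioms : Class → Equation → Set where
  basis  : ∀ {K eq} → Basis eq → Axioms K eq
  M-MC   : Axioms MC M-identity
  M-MBC  : Axioms MBC M-identity
  H-HBC  : Axioms HBC H-identity
  H-HBCK : Axioms HBCK H-identity
  K-HBCK : Axioms HBCK K-identity

valuation : {A : Set} → A → A → A → ℕ → A
valuation x y z 0             = x
valuation x y z 1             = y
valuation x y z (suc (suc _)) = z

module _ {A : Set} (_⇒_ : A → A → A) (e : A) where

  infix 4 _≤_
  _≤_ : A → A → Set
  x ≤ y = x ⇒ y ≡ e

  τ : A → A → A
  τ = t _⇒_ e

  τ-≤ : (∀ x → e ⇒ x ≡ x) → ∀ {x y} → x ≤ y → τ x y ≡ y
  τ-≤ e⇒-identity {x} {y} x≤y = trans (cong (_⇒ y) x≤y) (e⇒-identity y)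

  module ImplicativeAlgebra (imp : IsImplicativeAlgebra _⇒_ e) where

    ⇒-refl : ∀ x → x ≤ x
    ⇒-refl = proj₁ imp

    e⇒-identity : ∀ x → e ⇒ x ≡ x
    e⇒-identity = proj₁ (proj₂ imp)

    ≤-antisym : ∀ x y → x ≤ y → y ≤ x → x ≡ y
    ≤-antisym = proj₁ (proj₂ (proj₂ imp))

    ⇒-monoʳ-≤ : ∀ {x y z} → y ≤ z → (x ⇒ y) ≤ (x ⇒ z)
    ⇒-monoʳ-≤ {x} {y} {z} = proj₂ (proj₂ (proj₂ imp)) x y z

    ≤-trans : ∀ {x y z} → x ≤ y → y ≤ z → x ≤ z
    ≤-trans {x} {y} {z} x≤y y≤z = begin
      x ⇒ z               ≡⟨ e⇒-identity (x ⇒ z) ⟨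
      e ⇒ (x ⇒ z)         ≡⟨ cong (_⇒ (x ⇒ z)) x≤y ⟨
      (x ⇒ y) ⇒ (x ⇒ z)   ≡⟨ ⇒-monoʳ-≤ y≤z ⟩
      e                   ∎

    module Exchange (C : AxC _⇒_ e) where

      ≤-exchange : ∀ {x y z} → x ≤ y ⇒ z → y ≤ x ⇒ z
      ≤-exchange {x} {y} {z} = trans (C y x z)

      x≤τ : ∀ x y → x ≤ τ x y
      x≤τ x y = ≤-exchange (⇒-refl (x ⇒ y))

      ⇒-antimonoˡ-≤ : ∀ {x y z} → x ≤ y → (y ⇒ z) ≤ (x ⇒ z)
      ⇒-antimonoˡ-≤ {y = y} {z} x≤y = ≤-exchange (≤-trans x≤y (x≤τ y z))

      τ⇒≡⇒ : ∀ x y → τ x y ⇒ y ≡ x ⇒ y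
      τ⇒≡⇒ x y = ≤-antisym _ _ (⇒-antimonoˡ-≤ (x≤τ x y)) (x≤τ (x ⇒ y) y)

      τ⇒τ≡⇒τ : ∀ x s y → τ x y ⇒ τ s y ≡ x ⇒ τ s y
      τ⇒τ≡⇒τ x s y = begin
        τ x y ⇒ ((s ⇒ y) ⇒ y)   ≡⟨ C (τ x y) (s ⇒ y) y ⟩
        (s ⇒ y) ⇒ (τ x y ⇒ y)   ≡⟨ cong ((s ⇒ y) ⇒_) (τ⇒≡⇒ x y) ⟩
        (s ⇒ y) ⇒ (x ⇒ y)       ≡⟨ C (s ⇒ y) x y ⟩
        x ⇒ ((s ⇒ y) ⇒ y)       ∎

      axB : AxB _⇒_ e
      axB x y z = ≤-exchange (subst ((z ⇒ x) ≤_) (sym (C (x ⇒ y) z y)) (⇒-monoʳ-≤ (x≤τ x y)))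

      τ[⇒]≤⇒τ : ∀ v s y → τ (v ⇒ s) y ≤ v ⇒ τ s y
      τ[⇒]≤⇒τ v s y = begin
        τ (v ⇒ s) y ⇒ (v ⇒ ((s ⇒ y) ⇒ y))   ≡⟨ cong (τ (v ⇒ s) y ⇒_) (C v (s ⇒ y) y) ⟩
        τ (v ⇒ s) y ⇒ ((s ⇒ y) ⇒ (v ⇒ y))   ≡⟨ C (τ (v ⇒ s) y) (s ⇒ y) (v ⇒ y) ⟩
        (s ⇒ y) ⇒ (τ (v ⇒ s) y ⇒ (v ⇒ y))   ≡⟨ cong ((s ⇒ y) ⇒_) (C (τ (v ⇒ s) y) v y) ⟩
        (s ⇒ y) ⇒ (v ⇒ (τ (v ⇒ s) y ⇒ y))   ≡⟨ cong (λ w → (s ⇒ y) ⇒ (v ⇒ w)) (τ⇒≡⇒ (v ⇒ s) y) ⟩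
        (s ⇒ y) ⇒ (v ⇒ ((v ⇒ s) ⇒ y))       ≡⟨ cong ((s ⇒ y) ⇒_) (C v (v ⇒ s) y) ⟩
        (s ⇒ y) ⇒ ((v ⇒ s) ⇒ (v ⇒ y))       ≡⟨ axB s y v ⟩
        e                                   ∎

      H⇒M : AxH _⇒_ e → AxM _⇒_ e
      H⇒M H x y z = begin
        (τ x y ⇒ x) ⇒ (τ x y ⇒ z)   ≡⟨ H (τ x y) x z ⟩
        (x ⇒ τ x y) ⇒ (x ⇒ z)       ≡⟨ cong (_⇒ (x ⇒ z)) (x≤τ x y) ⟩
        e ⇒ (x ⇒ z)                 ≡⟨ e⇒-identity (x ⇒ z) ⟩
        x ⇒ z                       ∎

      module _ (M : AxM _⇒_ e) where

        M-≤ : ∀ {x w} → x ≤ w → ∀ z → (w ⇒ x) ⇒ (w ⇒ z) ≡ x ⇒ z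
        M-≤ {x} {w} x≤w z =
          subst (λ v → (v ⇒ x) ⇒ (v ⇒ z) ≡ x ⇒ z) (τ-≤ e⇒-identity x≤w) (M x w z)

        ≤-contraction : ∀ {d c} → d ≤ d ⇒ c → (d ⇒ c) ⇒ d ≤ d → d ≤ c
        ≤-contraction {d} {c} d≤q q⇒d≤d = begin
          d ⇒ c               ≡⟨ M-≤ d≤q c ⟨
          (q ⇒ d) ⇒ (q ⇒ c)   ≡⟨ ≤-trans q⇒d≤d (≤-exchange (⇒-refl q)) ⟩
          e                   ∎
          where q = d ⇒ c

        τ-fixed-point : ∀ x y → let a = τ (τ x y) x in a ≡ τ a y
        τ-fixed-point x y = ≤-antisym a w (x≤τ a y) w≤a
          where
            u = τ x y
            d = u ⇒ x
            a = d ⇒ x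
            w = τ a y

            u≤a : u ≤ a
            u≤a = x≤τ u x

            d≤w⇒a : d ≤ w ⇒ a
            d≤w⇒a = ≤-exchange (≤-trans (τ[⇒]≤⇒τ d x y) (⇒-monoʳ-≤ u≤a))

            a⇒u≤w⇒a : a ⇒ u ≤ w ⇒ a
            a⇒u≤w⇒a = subst (_≤ w ⇒ a) (τ⇒τ≡⇒τ a x y) (⇒-monoʳ-≤ u≤a)

            [w⇒a]⇒d≤d : (w ⇒ a) ⇒ d ≤ d
            [w⇒a]⇒d≤d = subst ((w ⇒ a) ⇒ d ≤_) (M-≤ u≤a x)
              (≤-trans (⇒-antimonoˡ-≤ a⇒u≤w⇒a) (⇒-monoʳ-≤ (≤-exchange (⇒-refl a))))

            w≤a : w ≤ a
            w≤a = trans (C w d x)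
              (≤-contraction (subst (d ≤_) (C w d x) d≤w⇒a)
                             (subst (λ q → q ⇒ d ≤ d) (C w d x) [w⇒a]⇒d≤d))

  InClass⇒MC : ∀ K → InClass K _⇒_ e → InClass MC _⇒_ e
  InClass⇒MC MC   k                 = k
  InClass⇒MC MBC  (imp , M , _ , C) = imp , M , C
  InClass⇒MC HBC  (imp , H , _ , C) = imp , ImplicativeAlgebra.Exchange.H⇒M imp C H , C
  InClass⇒MC HBCK (imp , H , _ , C , _) = imp , ImplicativeAlgebra.Exchange.H⇒M imp C H , C

  MC⇒Models-basis : InClass MC _⇒_ e → Models _⇒_ e Basis
  MC⇒Models-basis (imp , M , C) = models
    where
      open ImplicativeAlgebra imp
      open Exchange C

      models : Models _⇒_ e Basis
      models _ x⇒x≈e      ρ = ⇒-refl (ρ 0)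
      models _ e⇒x≈x      ρ = e⇒-identity (ρ 0)
      models _ C-identity ρ = C (ρ 0) (ρ 1) (ρ 2)
      models _ B-identity ρ = axB (ρ 0) (ρ 1) (ρ 2)
      models _ t-identity ρ = τ-fixed-point M (ρ 0) (ρ 1)

  module ModelOfBasis (sat : Models _⇒_ e Basis) where

    e⇒-identity : ∀ x → e ⇒ x ≡ x
    e⇒-identity x = sat _ e⇒x≈x (valuation x x x)

    axC : AxC _⇒_ e
    axC x y z = sat _ C-identity (valuation x y z)

    axB : AxB _⇒_ e
    axB x y z = sat _ B-identity (valuation x y z)

    ⇒-mono : ∀ x y z → y ≤ z → (x ⇒ y) ≤ (x ⇒ z)
    ⇒-mono x y z y≤z = begin
      (x ⇒ y) ⇒ (x ⇒ z)             ≡⟨ e⇒-identity _ ⟨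
      e ⇒ ((x ⇒ y) ⇒ (x ⇒ z))       ≡⟨ cong (_⇒ ((x ⇒ y) ⇒ (x ⇒ z))) y≤z ⟨
      (y ⇒ z) ⇒ ((x ⇒ y) ⇒ (x ⇒ z)) ≡⟨ axB y z x ⟩
      e                             ∎

    ≤-antisym : ∀ x y → x ≤ y → y ≤ x → x ≡ y
    ≤-antisym x y x≤y y≤x = begin
      x                   ≡⟨ τ[τxy,x]≡x ⟨
      τ (τ x y) x         ≡⟨ sat _ t-identity (valuation x y y) ⟩
      τ (τ (τ x y) x) y   ≡⟨ cong (λ v → τ v y) τ[τxy,x]≡x ⟩
      τ x y               ≡⟨ τ-≤ e⇒-identity x≤y ⟩
      y                   ∎
      where
        τ[τxy,x]≡x : τ (τ x y) x ≡ x
        τ[τxy,x]≡x = trans (cong (λ v → τ v x) (τ-≤ e⇒-identity x≤y)) (τ-≤ e⇒-identity y≤x)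

    isImplicativeAlgebra : IsImplicativeAlgebra _⇒_ e
    isImplicativeAlgebra = (λ x → sat _ x⇒x≈e (valuation x x x)) , e⇒-identity , ≤-antisym , ⇒-mono

  InClass⇒Models : ∀ K → InClass K _⇒_ e → Models _⇒_ e (Axioms K)
  InClass⇒Models K    k                   _ (basis b) = MC⇒Models-basis (InClass⇒MC K k) _ b
  InClass⇒Models MC   (_ , M , _)         _ M-MC      ρ = M (ρ 0) (ρ 1) (ρ 2)
  InClass⇒Models MBC  (_ , M , _)         _ M-MBC     ρ = M (ρ 0) (ρ 1) (ρ 2)
  InClass⇒Models HBC  (_ , H , _)         _ H-HBC     ρ = H (ρ 0) (ρ 1) (ρ 2)
  InClass⇒Models HBCK (_ , H , _)         _ H-HBCK    ρ = H (ρ 0) (ρ 1) (ρ 2)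
  InClass⇒Models HBCK (_ , _ , _ , _ , K) _ K-HBCK    ρ = K (ρ 0) (ρ 1)

  Axioms⇒Basis : ∀ {K} → Models _⇒_ e (Axioms K) → Models _⇒_ e Basis
  Axioms⇒Basis sat _ b = sat _ (basis b)

  Models⇒InClass : ∀ K → Models _⇒_ e (Axioms K) → InClass K _⇒_ e
  Models⇒InClass MC sat = isImplicativeAlgebra , (λ x y z → sat _ M-MC (valuation x y z)) , axC
    where open ModelOfBasis (Axioms⇒Basis sat)
  Models⇒InClass MBC sat = isImplicativeAlgebra , (λ x y z → sat _ M-MBC (valuation x y z)) , axB , axC
    where open ModelOfBasis (Axioms⇒Basis sat)
  Models⇒InClass HBC sat = isImplicativeAlgebra , (λ x y z → sat _ H-HBC (valuation x y z)) , axB , axC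
    where open ModelOfBasis (Axioms⇒Basis sat)
  Models⇒InClass HBCK sat =
    isImplicativeAlgebra , (λ x y z → sat _ H-HBCK (valuation x y z)) , axB , axC
      , (λ x y → sat _ K-HBCK (valuation x y y))
    where open ModelOfBasis (Axioms⇒Basis sat)

mainTheorem4 : (K : Class) → Σ (Equation → Set) λ E →
                 ∀ (A : Set) (_⇒_ : A → A → A) (e : A) →
                   InClass K _⇒_ e ⇔ Models _⇒_ e E
mainTheorem4 K = Axioms K , λ A _⇒_ e → mk⇔ (InClass⇒Models _⇒_ e K) (Models⇒InClass _⇒_ e K)
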